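{- (Generation.) (1) If $\Gamma\vdash_{SM}\underline{n}:\tau$, then $\Gamma_n=\tau$. (2) If $\Gamma\vdash_{SM_r}\underline{n}:\tau$, then $\tau=\sigma_1\to\cdots\to\sigma_k\to\alpha$ for some $k\ge0$, $\sigma_1,\dots,\sigma_k\in\mathcal{T}$ and $\alpha\in\mathcal{A}$. (3) If $nil\vdash_{SM}\lambda.M:\tau$, then either $\tau=\omega\to\sigma$ and $nil\vdash_{SM} M:\sigma$, or $\tau=(\sigma_1\wedge\cdots\wedge\sigma_n)\to\sigma$ with $n>0$ and $(\sigma_1\wedge\cdots\wedge\sigma_n).nil\vdash_{SM}M:\sigma$, for some $\sigma,\sigma_1,\dots,\sigma_n\in\mathcal{T}$. (4) If $\Gamma\vdash_{SM}\lambda.M:\tau$ and $|\Gamma|>0$, then $\tau=u\to\sigma$ for some $u\in\mathcal{U}$ and $\sigma\in\mathcal{T}$ with $u.\Gamma\vdash_{SM}M:\sigma$. (5) If $\Gamma\vdash_{SM_r}\underline{n}\,M_1\cdots M_m:\tau$, then there are $\sigma_1,\dots,\sigma_{m+k}\in\mathcal{T}$ ($k\ge0$), $\alpha\in\mathcal{A}$ and contexts $\Gamma^1,\dots,\Gamma^m$ such that $\Gamma=(\omega^{n-1}.(\sigma_1\to\cdots\to\sigma_m\to\tau).nil)\wedge\Gamma^1\wedge\cdots\wedge\Gamma^m$, $\Gamma^i\vdash_{SM_r}M_i:\sigma_i$ for all $1\le i\le m$, and $\tau=\sigma_{m+1}\to\cdots\to\sigma_{m+k}\to\alpha$.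
   Context: Terms (de Bruijn): $M,N::=\underline{n}\mid (M\,N)\mid\lambda.M$, $n\in\mathbb{N}^*$; application associates to the left. Types: $\mathcal{A}$ is a denumerable set of type variables; $\tau,\sigma\in\mathcal{T}::=\alpha\mid u\to\tau$ and $u\in\mathcal{U}::=\omega\mid u\wedge u\mid\tau$, with $\wedge$ commutative, associative and having $\omega$ as neutral element; $\to$ associates to the right. Contexts are lists $\Gamma::=nil\mid u.\Gamma$ with $u\in\mathcal{U}$; $\Gamma_i$ is the $i$-th element, $|\Gamma|$ the length; $\omega^{k}.\Gamma$ denotes $\Gamma$ prefixed by $k$ copies of $\omega$ ($\omega^0.\Gamma=\Gamma$). Intersection of contexts: $nil\wedge\Gamma=\Gamma\wedge nil=\Gamma$, $(u_1.\Gamma)\wedge(u_2.\Delta)=(u_1\wedge u_2).(\Gamma\wedge\Delta)$. System $SM$ derives judgements $\Gamma\vdash M:\tau$ ($\tau\in\mathcal{T}$) by: (var) $\tau.nil\vdash\underline{1}:\tau$; (varn) from $\Gamma\vdash\underline{n}:\tau$ infer $\omega.\Gamma\vdash\underline{n+1}:\tau$; ($\to_i$) from $u.\Gamma\vdash M:\tau$ infer $\Gamma\vdash\lambda.M:u\to\tau$; ($\to_i'$) from $nil\vdash M:\tau$ infer $nil\vdash\lambda.M:\omega\to\tau$; ($\to_e'$) from $\Gamma\vdash M_1:\omega\to\tau$ and $\Delta\vdash M_2:\sigma$ infer $\Gamma\wedge\Delta\vdash (M_1\,M_2):\tau$; ($\to_e$) from $\Gamma\vdash M_1:(\sigma_1\wedge\cdots\wedge\sigma_n)\to\tau$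 ($n\ge1$, $\sigma_i\in\mathcal{T}$) and $\Delta^i\vdash M_2:\sigma_i$ for all $i$ infer $\Gamma\wedge\Delta^1\wedge\cdots\wedge\Delta^n\vdash(M_1\,M_2):\tau$. System $SM_r$ is $SM$ with (var) replaced by (var$_r$): $(\sigma_1\to\cdots\to\sigma_n\to\alpha).nil\vdash\underline{1}:\sigma_1\to\cdots\to\sigma_n\to\alpha$ for any $n\ge0$, $\sigma_i\in\mathcal{T}$, $\alpha\in\mathcal{A}$. $\Gamma\vdash_S M:\tau$ means derivability in system $S$. -}

module Defs where

open import Data.Nat using (ℕ; zero; suc)
open import Data.Fin using (Fin)
open import Data.List using (List; []; _∷_; _++_; foldr; tabulate; length; lookup)
open import Data.List.Relation.Binary.Pointwise using (Pointwise)
open import Data.Maybe using (Maybe; just; nothing)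

-- Terms (de Bruijn).  `var k` is the index  underline{k+1}  (indices are ≥ 1).

data Term : Set where
  var : ℕ → Term
  _·_ : Term → Term → Term
  ƛ_  : Term → Term

infixl 7 _·_
infix  5 ƛ_

apps : Term → List Term → Term
apps M []       = M
apps M (N ∷ Ns) = apps (M · N) Ns

-- An element of 𝒰 is represented by the list of its components:
--   ω = [] ,  u ∧ v = u ++ v ,  τ = [ τ ].
-- Equality in 𝒰 (comm./assoc., ω neutral, NOT idempotent) is
-- permutation of the component lists, nested: ≈T / ≈U below.

data Ty : Set where
  tv  : ℕ → Ty
  _⇒_ : List Ty → Ty → Ty

infixr 6 _⇒_

U : Set
U = List Ty

ω : U
ω = []

mutual
  data _≈T_ : Ty → Ty → Set where
    tv-≈  : ∀ {a} → tv a ≈T tv a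
    ⇒-≈   : ∀ {u u′ τ τ′} → u ≈U u′ → τ ≈T τ′ → (u ⇒ τ) ≈T (u′ ⇒ τ′)

  data _≈U_ : List Ty → List Ty → Set where
    []-≈    : [] ≈U []
    ∷-≈     : ∀ {x y xs ys} → x ≈T y → xs ≈U ys → (x ∷ xs) ≈U (y ∷ ys)
    swap-≈  : ∀ {x y xs} → (x ∷ y ∷ xs) ≈U (y ∷ x ∷ xs)
    trans-≈ : ∀ {xs ys zs} → xs ≈U ys → ys ≈U zs → xs ≈U zs

infix 4 _≈T_ _≈U_ _≈C_

_⇛_ : List Ty → Ty → Ty
[]       ⇛ τ = τ
(σ ∷ σs) ⇛ τ = (σ ∷ []) ⇒ (σs ⇛ τ)

infixr 6 _⇛_

-- Contexts: lists of elements of 𝒰 (head = index 1).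

Ctx : Set
Ctx = List U

_≈C_ : Ctx → Ctx → Set
_≈C_ = Pointwise _≈U_

_∧C_ : Ctx → Ctx → Ctx
[]      ∧C Δ       = Δ
(u ∷ Γ) ∧C []      = u ∷ Γ
(u ∷ Γ) ∧C (v ∷ Δ) = (u ++ v) ∷ (Γ ∧C Δ)

infixr 6 _∧C_

⋀ : List Ctx → Ctx
⋀ = foldr _∧C_ []

ωs : ℕ → Ctx → Ctx
ωs zero    Γ = Γ
ωs (suc k) Γ = ω ∷ ωs k Γ

-- Γ_{k+1}  (nothing if out of range)
_!_ : Ctx → ℕ → Maybe U
[]      ! _     = nothing
(u ∷ Γ) ! zero  = just u
(u ∷ Γ) ! suc k = Γ ! k

data System : Set where
  SM SMr : System

-- Derivations are on representatives; the rule `conv` makes derivability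
-- invariant under the equalities of 𝒯/𝒰 (i.e. it models derivability on the
-- quotient).
data _⊢⟨_⟩_∶_ : Ctx → System → Term → Ty → Set where
  ax     : ∀ {τ} → ((τ ∷ []) ∷ []) ⊢⟨ SM ⟩ var zero ∶ τ
  ax-r   : ∀ (σs : List Ty) (a : ℕ) →
           ((σs ⇛ tv a ∷ []) ∷ []) ⊢⟨ SMr ⟩ var zero ∶ (σs ⇛ tv a)
  varn   : ∀ {S Γ k τ} → Γ ⊢⟨ S ⟩ var k ∶ τ → (ω ∷ Γ) ⊢⟨ S ⟩ var (suc k) ∶ τ
  →i     : ∀ {S Γ u M τ} → (u ∷ Γ) ⊢⟨ S ⟩ M ∶ τ → Γ ⊢⟨ S ⟩ ƛ M ∶ (u ⇒ τ)
  →i′    : ∀ {S M τ} → [] ⊢⟨ S ⟩ M ∶ τ → [] ⊢⟨ S ⟩ ƛ M ∶ (ω ⇒ τ)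
  →e′    : ∀ {S Γ Δ M₁ M₂ τ σ} → Γ ⊢⟨ S ⟩ M₁ ∶ (ω ⇒ τ) → Δ ⊢⟨ S ⟩ M₂ ∶ σ →
           (Γ ∧C Δ) ⊢⟨ S ⟩ M₁ · M₂ ∶ τ
  →e     : ∀ {S Γ M₁ M₂ τ n} (σ : Fin (suc n) → Ty) (Δ : Fin (suc n) → Ctx) →
           Γ ⊢⟨ S ⟩ M₁ ∶ (tabulate σ ⇒ τ) → (∀ i → Δ i ⊢⟨ S ⟩ M₂ ∶ σ i) →
           (Γ ∧C ⋀ (tabulate Δ)) ⊢⟨ S ⟩ M₁ · M₂ ∶ τ
  conv   : ∀ {S Γ Γ′ M τ τ′} → Γ ≈C Γ′ → τ ≈T τ′ →
           Γ ⊢⟨ S ⟩ M ∶ τ → Γ′ ⊢⟨ S ⟩ M ∶ τ′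

infix 3 _⊢⟨_⟩_∶_

-- Parts (1), (3) and (4) invert the last rule of a derivation, commuting it past the
-- conversion rule. In (3) the case (→i) with u = ω is impossible because a derivable context
-- never ends in ω. For (5), and (2) as its case m = 0, one inverts along the application
-- spine of the term: its head variable is typed by (var_r), whose type has a single type in
-- each argument position, so every application on the spine is an instance of (→e) with n = 1.
module Submission where

open import Data.Empty using (⊥-elim)
open import Data.Fin using (Fin; zero; suc)
open import Data.List using (List; []; _∷_; _++_; _∷ʳ_; length; lookup; tabulate)
open import Data.List.Properties using (++-assoc; ++-identityʳ; length-tabulate)
import Data.List.Relation.Binary.Pointwise as Pointwise
open import Data.List.Relation.Binary.Pointwise using ([]; _∷_)
open import Data.List.Relation.Unary.All using (All; []; _∷_)
open import Data.List.Relation.Unary.All.Properties using (tabulate⁺)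
open import Data.Maybe using (just)
open import Data.Nat using (ℕ; zero; suc; _<_; z≤n; s≤s)
open import Data.Nat.Properties using (n≮0; suc-injective)
open import Data.Product using (∃-syntax; _×_; _,_)
open import Data.Sum using (_⊎_; inj₁; inj₂)
open import Data.Unit using (⊤)
open import Data.Vec.Functional using () renaming (_∷_ to _◂_)
open import Relation.Binary.Bundles using (Setoid)
open import Relation.Binary.Definitions using (Reflexive; Symmetric; Transitive)
open import Relation.Binary.PropositionalEquality using (_≡_; refl; sym; trans; cong; cong₂; subst)

open import Defs

mutual
  ≈T-refl : Reflexive _≈T_
  ≈T-refl {tv a}  = tv-≈
  ≈T-refl {u ⇒ τ} = ⇒-≈ ≈U-refl ≈T-refl

  ≈U-refl : Reflexive _≈U_
  ≈U-refl {[]}    = []-≈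
  ≈U-refl {τ ∷ u} = ∷-≈ ≈T-refl ≈U-refl

mutual
  ≈T-sym : Symmetric _≈T_
  ≈T-sym tv-≈      = tv-≈
  ≈T-sym (⇒-≈ p q) = ⇒-≈ (≈U-sym p) (≈T-sym q)

  ≈U-sym : Symmetric _≈U_
  ≈U-sym []-≈          = []-≈
  ≈U-sym (∷-≈ p q)     = ∷-≈ (≈T-sym p) (≈U-sym q)
  ≈U-sym swap-≈        = swap-≈
  ≈U-sym (trans-≈ p q) = trans-≈ (≈U-sym q) (≈U-sym p)

≈T-trans : Transitive _≈T_
≈T-trans tv-≈      tv-≈        = tv-≈
≈T-trans (⇒-≈ p q) (⇒-≈ p′ q′) = ⇒-≈ (trans-≈ p p′) (≈T-trans q q′)

≈U-length : ∀ {u v} → u ≈U v → length u ≡ length v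
≈U-length []-≈          = refl
≈U-length (∷-≈ _ p)     = cong suc (≈U-length p)
≈U-length swap-≈        = refl
≈U-length (trans-≈ p q) = trans (≈U-length p) (≈U-length q)

≈U-++⁺ʳ : ∀ {u v} w → u ≈U v → u ++ w ≈U v ++ w
≈U-++⁺ʳ w []-≈          = ≈U-refl
≈U-++⁺ʳ w (∷-≈ p q)     = ∷-≈ p (≈U-++⁺ʳ w q)
≈U-++⁺ʳ w swap-≈        = swap-≈
≈U-++⁺ʳ w (trans-≈ p q) = trans-≈ (≈U-++⁺ʳ w p) (≈U-++⁺ʳ w q)

≈U-setoid : Setoid _ _
≈U-setoid = record
  { Carrier       = U
  ; _≈_           = _≈U_
  ; isEquivalence = record { refl = ≈U-refl ; sym = ≈U-sym ; trans = trans-≈ }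
  }

≈C-setoid : Setoid _ _
≈C-setoid = Pointwise.setoid ≈U-setoid

open Setoid ≈C-setoid using () renaming (refl to ≈C-refl; sym to ≈C-sym; trans to ≈C-trans)

⇛-cong : ∀ σs {τ τ′} → τ ≈T τ′ → σs ⇛ τ ≈T σs ⇛ τ′
⇛-cong []       p = p
⇛-cong (σ ∷ σs) p = ⇒-≈ ≈U-refl (⇛-cong σs p)

⇛-++ : ∀ σs ρs τ → (σs ++ ρs) ⇛ τ ≡ σs ⇛ ρs ⇛ τ
⇛-++ []       ρs τ = refl
⇛-++ (σ ∷ σs) ρs τ = cong ((σ ∷ []) ⇒_) (⇛-++ σs ρs τ)

∧C-identityʳ : ∀ Γ → Γ ∧C [] ≡ Γ
∧C-identityʳ []      = refl
∧C-identityʳ (_ ∷ _) = refl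

∧C-assoc : ∀ Γ Δ Θ → (Γ ∧C Δ) ∧C Θ ≡ Γ ∧C (Δ ∧C Θ)
∧C-assoc []      Δ       Θ       = refl
∧C-assoc (u ∷ Γ) []      Θ       = refl
∧C-assoc (u ∷ Γ) (v ∷ Δ) []      = refl
∧C-assoc (u ∷ Γ) (v ∷ Δ) (w ∷ Θ) = cong₂ _∷_ (++-assoc u v w) (∧C-assoc Γ Δ Θ)

∧C-congˡ : ∀ {Γ Γ′} → Γ ≈C Γ′ → ∀ Δ → Γ ∧C Δ ≈C Γ′ ∧C Δ
∧C-congˡ []       Δ       = ≈C-refl
∧C-congˡ (p ∷ ps) []      = p ∷ ps
∧C-congˡ (p ∷ ps) (v ∷ Δ) = ≈U-++⁺ʳ v p ∷ ∧C-congˡ ps Δ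

⋀-++ : ∀ Γs Δs → ⋀ (Γs ++ Δs) ≡ ⋀ Γs ∧C ⋀ Δs
⋀-++ []       Δs = refl
⋀-++ (Γ ∷ Γs) Δs = trans (cong (Γ ∧C_) (⋀-++ Γs Δs)) (sym (∧C-assoc Γ (⋀ Γs) (⋀ Δs)))

varCtx : ℕ → Ty → Ctx
varCtx k τ = ωs k ((τ ∷ []) ∷ [])

varCtx-cong : ∀ k {τ τ′} → τ ≈T τ′ → varCtx k τ ≈C varCtx k τ′
varCtx-cong zero    p = ∷-≈ p []-≈ ∷ []
varCtx-cong (suc k) p = []-≈ ∷ varCtx-cong k p

!-resp-≈C : ∀ {Γ Δ k u} → Γ ≈C Δ → Γ ! k ≡ just u → ∃[ v ] (Δ ! k ≡ just v × u ≈U v)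
!-resp-≈C {k = zero}  (p ∷ _)  refl = _ , refl , p
!-resp-≈C {k = suc k} (_ ∷ ps) eq   = !-resp-≈C ps eq

!≡just⇒nonempty : ∀ Γ {k u} → Γ ! k ≡ just u → 0 < length Γ
!≡just⇒nonempty (_ ∷ _) _ = s≤s z≤n

var-lookup : ∀ {S Γ k τ} → Γ ⊢⟨ S ⟩ var k ∶ τ → ∃[ u ] (Γ ! k ≡ just u × u ≈U τ ∷ [])
var-lookup ax         = _ , refl , ≈U-refl
var-lookup (ax-r _ _) = _ , refl , ≈U-refl
var-lookup (varn d)   = var-lookup d
var-lookup (conv Γ≈Γ′ τ≈τ′ d) with var-lookup d
... | u , Γₖ≡u , u≈τ with !-resp-≈C Γ≈Γ′ Γₖ≡u
... | u′ , Γ′ₖ≡u′ , u≈u′ = u′ , Γ′ₖ≡u′ , trans-≈ (≈U-sym u≈u′) (trans-≈ u≈τ (∷-≈ τ≈τ′ []-≈))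

NoTrailingω : Ctx → Set
NoTrailingω []          = ⊤
NoTrailingω (u ∷ [])    = 0 < length u
NoTrailingω (_ ∷ v ∷ Γ) = NoTrailingω (v ∷ Γ)

NoTrailingω-resp-≈C : ∀ {Γ Δ} → Γ ≈C Δ → NoTrailingω Γ → NoTrailingω Δ
NoTrailingω-resp-≈C []           h = h
NoTrailingω-resp-≈C (p ∷ [])     h = subst (0 <_) (≈U-length p) h
NoTrailingω-resp-≈C (_ ∷ p ∷ ps) h = NoTrailingω-resp-≈C (p ∷ ps) h

NoTrailingω-∧C : ∀ Γ Δ → NoTrailingω Γ → NoTrailingω Δ → NoTrailingω (Γ ∧C Δ)
NoTrailingω-∧C []             Δ           _ h  = h
NoTrailingω-∧C (_ ∷ _)        []          h _  = h
NoTrailingω-∧C ((_ ∷ _) ∷ []) (_ ∷ [])    _ _  = s≤s z≤n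
NoTrailingω-∧C (_ ∷ [])       (_ ∷ _ ∷ _) _ h  = h
NoTrailingω-∧C (_ ∷ _ ∷ _)    (_ ∷ [])    h _  = h
NoTrailingω-∧C (_ ∷ v ∷ Γ)    (_ ∷ w ∷ Δ) h h′ = NoTrailingω-∧C (v ∷ Γ) (w ∷ Δ) h h′

NoTrailingω-⋀ : ∀ {Γs} → All NoTrailingω Γs → NoTrailingω (⋀ Γs)
NoTrailingω-⋀ []                = _
NoTrailingω-⋀ {Γ ∷ Γs} (h ∷ hs) = NoTrailingω-∧C Γ (⋀ Γs) h (NoTrailingω-⋀ hs)

NoTrailingω-∷⁻ : ∀ {u} Γ → NoTrailingω (u ∷ Γ) → NoTrailingω Γ
NoTrailingω-∷⁻ []      _ = _
NoTrailingω-∷⁻ (_ ∷ _) h = h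

NoTrailingω-∷⁺ : ∀ {u} Γ → NoTrailingω Γ → 0 < length Γ → NoTrailingω (u ∷ Γ)
NoTrailingω-∷⁺ (_ ∷ _) h _ = h

⊢⇒NoTrailingω : ∀ {S Γ M τ} → Γ ⊢⟨ S ⟩ M ∶ τ → NoTrailingω Γ
⊢⇒NoTrailingω ax                 = s≤s z≤n
⊢⇒NoTrailingω (ax-r _ _)         = s≤s z≤n
⊢⇒NoTrailingω (varn {Γ = Γ} d)   =
  let _ , Γₖ≡u , _ = var-lookup d in NoTrailingω-∷⁺ Γ (⊢⇒NoTrailingω d) (!≡just⇒nonempty Γ Γₖ≡u)
⊢⇒NoTrailingω (→i {Γ = Γ} d)     = NoTrailingω-∷⁻ Γ (⊢⇒NoTrailingω d)
⊢⇒NoTrailingω (→i′ _)            = _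
⊢⇒NoTrailingω (→e′ {Γ = Γ} {Δ = Δ} d e) =
  NoTrailingω-∧C Γ Δ (⊢⇒NoTrailingω d) (⊢⇒NoTrailingω e)
⊢⇒NoTrailingω (→e {Γ = Γ} _ Δ d es) =
  NoTrailingω-∧C Γ (⋀ (tabulate Δ)) (⊢⇒NoTrailingω d)
    (NoTrailingω-⋀ (tabulate⁺ {f = Δ} (λ i → ⊢⇒NoTrailingω (es i))))
⊢⇒NoTrailingω (conv Γ≈Γ′ _ d)    = NoTrailingω-resp-≈C Γ≈Γ′ (⊢⇒NoTrailingω d)

ƛ-inversion : ∀ {S Γ M τ} → Γ ⊢⟨ S ⟩ ƛ M ∶ τ →
  (∃[ u ] ∃[ σ ] (τ ≈T u ⇒ σ × (u ∷ Γ) ⊢⟨ S ⟩ M ∶ σ))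
  ⊎ (Γ ≡ [] × ∃[ σ ] (τ ≈T ω ⇒ σ × [] ⊢⟨ S ⟩ M ∶ σ))
ƛ-inversion (→i d)  = inj₁ (_ , _ , ≈T-refl , d)
ƛ-inversion (→i′ d) = inj₂ (refl , _ , ≈T-refl , d)
ƛ-inversion (conv Γ≈Γ′ τ≈τ′ d) with ƛ-inversion d
... | inj₁ (u , σ , τ≈ , d′) = inj₁ (u , σ , ≈T-trans (≈T-sym τ≈τ′) τ≈ , conv (≈U-refl ∷ Γ≈Γ′) ≈T-refl d′)
... | inj₂ (refl , σ , τ≈ , d′) with Γ≈Γ′
...   | [] = inj₂ (refl , σ , ≈T-trans (≈T-sym τ≈τ′) τ≈ , d′)

closed-ƛ-inversion : ∀ {S M τ} → [] ⊢⟨ S ⟩ ƛ M ∶ τ →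
  (∃[ σ ] (τ ≈T ω ⇒ σ × [] ⊢⟨ S ⟩ M ∶ σ))
  ⊎ (∃[ σ ] ∃[ σ₁ ] ∃[ σs ] (τ ≈T (σ₁ ∷ σs) ⇒ σ × ((σ₁ ∷ σs) ∷ []) ⊢⟨ S ⟩ M ∶ σ))
closed-ƛ-inversion d with ƛ-inversion d
... | inj₁ ([] , _ , _ , d′)       = ⊥-elim (n≮0 (⊢⇒NoTrailingω d′))
... | inj₁ (σ₁ ∷ σs , σ , τ≈ , d′) = inj₂ (σ , σ₁ , σs , τ≈ , d′)
... | inj₂ (_ , σ , τ≈ , d′)       = inj₁ (σ , τ≈ , d′)

open-ƛ-inversion : ∀ {S Γ M τ} → Γ ⊢⟨ S ⟩ ƛ M ∶ τ → 0 < length Γ →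
  ∃[ u ] ∃[ σ ] (τ ≈T u ⇒ σ × (u ∷ Γ) ⊢⟨ S ⟩ M ∶ σ)
open-ƛ-inversion d Γ≢[] with ƛ-inversion d
... | inj₁ h          = h
... | inj₂ (refl , _) = ⊥-elim (n≮0 Γ≢[])

data Spine : Term → ℕ → List Term → Set where
  head : ∀ {k} → Spine (var k) k []
  app  : ∀ {M k Ms N} → Spine M k Ms → Spine (M · N) k (Ms ∷ʳ N)

Spine-apps : ∀ {M k Ms} → Spine M k Ms → ∀ Ns → Spine (apps M Ns) k (Ms ++ Ns)
Spine-apps {Ms = Ms} s []       = subst (Spine _ _) (sym (++-identityʳ Ms)) s
Spine-apps {Ms = Ms} s (N ∷ Ns) = subst (Spine _ _) (++-assoc Ms (N ∷ []) Ns) (Spine-apps (app s) Ns)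

data _⊢⟨_⟩⋆_∶_ : List Ctx → System → List Term → List Ty → Set where
  []  : ∀ {S} → [] ⊢⟨ S ⟩⋆ [] ∶ []
  _∷_ : ∀ {S Δ Δs N Ns σ σs} → Δ ⊢⟨ S ⟩ N ∶ σ → Δs ⊢⟨ S ⟩⋆ Ns ∶ σs →
        (Δ ∷ Δs) ⊢⟨ S ⟩⋆ (N ∷ Ns) ∶ (σ ∷ σs)

infix 3 _⊢⟨_⟩⋆_∶_

_∷ʳ⋆_ : ∀ {S Δs Ns σs Δ N σ} → Δs ⊢⟨ S ⟩⋆ Ns ∶ σs → Δ ⊢⟨ S ⟩ N ∶ σ →
        (Δs ∷ʳ Δ) ⊢⟨ S ⟩⋆ (Ns ∷ʳ N) ∶ (σs ∷ʳ σ)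
[]       ∷ʳ⋆ e = e ∷ []
(d ∷ ds) ∷ʳ⋆ e = d ∷ (ds ∷ʳ⋆ e)

⊢⋆-tabulate : ∀ {S Δs Ns σs} → Δs ⊢⟨ S ⟩⋆ Ns ∶ σs →
  ∃[ σ ] ∃[ Δ ] (tabulate {n = length Ns} σ ≡ σs × tabulate Δ ≡ Δs × (∀ i → Δ i ⊢⟨ S ⟩ lookup Ns i ∶ σ i))
⊢⋆-tabulate []       = (λ ()) , (λ ()) , refl , refl , λ ()
⊢⋆-tabulate (d ∷ ds) with ⊢⋆-tabulate ds
... | σ , Δ , refl , refl , es = (_ ◂ σ) , (_ ◂ Δ) , refl , refl , λ { zero → d ; (suc i) → es i }

EndsInTyVar : Ty → Set
EndsInTyVar τ = ∃[ ρs ] ∃[ a ] (τ ≈T ρs ⇛ tv a)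

EndsInTyVar-resp-≈T : ∀ {τ τ′} → τ ≈T τ′ → EndsInTyVar τ → EndsInTyVar τ′
EndsInTyVar-resp-≈T τ≈τ′ (ρs , a , τ≈) = ρs , a , ≈T-trans (≈T-sym τ≈τ′) τ≈

EndsInTyVar-⇒ : ∀ {u τ} → EndsInTyVar (u ⇒ τ) → length u ≡ 1 × EndsInTyVar τ
EndsInTyVar-⇒ ([]     , _ , ())
EndsInTyVar-⇒ (_ ∷ ρs , a , ⇒-≈ u≈ρ τ≈) = ≈U-length u≈ρ , ρs , a , τ≈

tabulate-length≡1 : ∀ {A : Set} {n} (f : Fin (suc n) → A) → length (tabulate f) ≡ 1 → n ≡ 0
tabulate-length≡1 f eq = suc-injective (trans (sym (length-tabulate f)) eq)

SpineTyping : ℕ → Ctx → List Term → Ty → Set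
SpineTyping k Γ Ms τ = ∃[ σs ] ∃[ Δs ]
  (Δs ⊢⟨ SMr ⟩⋆ Ms ∶ σs × Γ ≈C varCtx k (σs ⇛ τ) ∧C ⋀ Δs × EndsInTyVar τ)

varCtx-∧C-snoc : ∀ {Γ} k σs σ τ Δs Δ → Γ ≈C varCtx k (σs ⇛ (σ ∷ []) ⇒ τ) ∧C ⋀ Δs →
  Γ ∧C ⋀ (Δ ∷ []) ≈C varCtx k ((σs ∷ʳ σ) ⇛ τ) ∧C ⋀ (Δs ∷ʳ Δ)
varCtx-∧C-snoc {Γ} k σs σ τ Δs Δ Γ≈ = begin
  Γ ∧C ⋀ (Δ ∷ [])
    ≈⟨ ∧C-congˡ Γ≈ (⋀ (Δ ∷ [])) ⟩
  (varCtx k (σs ⇛ (σ ∷ []) ⇒ τ) ∧C ⋀ Δs) ∧C ⋀ (Δ ∷ [])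
    ≡⟨ ∧C-assoc (varCtx k (σs ⇛ (σ ∷ []) ⇒ τ)) (⋀ Δs) (⋀ (Δ ∷ [])) ⟩
  varCtx k (σs ⇛ (σ ∷ []) ⇒ τ) ∧C (⋀ Δs ∧C ⋀ (Δ ∷ []))
    ≡⟨ cong₂ (λ ρ Θ → varCtx k ρ ∧C Θ) (sym (⇛-++ σs (σ ∷ []) τ)) (sym (⋀-++ Δs (Δ ∷ []))) ⟩
  varCtx k ((σs ∷ʳ σ) ⇛ τ) ∧C ⋀ (Δs ∷ʳ Δ) ∎
  where open import Relation.Binary.Reasoning.Setoid ≈C-setoid

Spine-inversion : ∀ {Γ M k Ms τ} → Spine M k Ms → Γ ⊢⟨ SMr ⟩ M ∶ τ → SpineTyping k Γ Ms τ
Spine-inversion head (ax-r σs a) = [] , [] , [] , ≈C-refl , σs , a , ≈T-refl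
Spine-inversion head (varn d) with Spine-inversion head d
... | [] , [] , [] , Γ≈ , τ↓ = [] , [] , [] , []-≈ ∷ subst (_ ≈C_) (∧C-identityʳ _) Γ≈ , τ↓
Spine-inversion {k = k} s (conv Γ≈Γ′ τ≈τ′ d) with Spine-inversion s d
... | σs , Δs , ts , Γ≈ , τ↓ =
  σs , Δs , ts ,
  ≈C-trans (≈C-sym Γ≈Γ′) (≈C-trans Γ≈ (∧C-congˡ (varCtx-cong k (⇛-cong σs τ≈τ′)) (⋀ Δs))) ,
  EndsInTyVar-resp-≈T τ≈τ′ τ↓
Spine-inversion (app s) (→e′ d _) with Spine-inversion s d
... | _ , _ , _ , _ , ω⇒τ↓ with EndsInTyVar-⇒ ω⇒τ↓
... | () , _
Spine-inversion {k = k} (app s) (→e σ Δ d es) with Spine-inversion s d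
... | σs , Δs , ts , Γ≈ , σ⇒τ↓ with EndsInTyVar-⇒ σ⇒τ↓
... | |σ|≡1 , τ↓ with tabulate-length≡1 σ |σ|≡1
... | refl =
  σs ∷ʳ σ zero , Δs ∷ʳ Δ zero , ts ∷ʳ⋆ es zero ,
  varCtx-∧C-snoc k σs (σ zero) _ Δs (Δ zero) Γ≈ , τ↓

apps-inversion : ∀ {Γ k τ} Ms → Γ ⊢⟨ SMr ⟩ apps (var k) Ms ∶ τ →
  ∃[ σ ] ∃[ ρs ] ∃[ a ] ∃[ Γs ]
    (Γ ≈C varCtx k (tabulate {n = length Ms} σ ⇛ τ) ∧C ⋀ (tabulate Γs)
     × (∀ i → Γs i ⊢⟨ SMr ⟩ lookup Ms i ∶ σ i)
     × τ ≈T ρs ⇛ tv a)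
apps-inversion Ms d with Spine-inversion (Spine-apps head Ms) d
... | _ , _ , ts , Γ≈ , ρs , a , τ≈ with ⊢⋆-tabulate ts
... | σ , Γs , refl , refl , es = σ , ρs , a , Γs , Γ≈ , es , τ≈

lemma2p5 :
    (∀ {Γ k τ} → Γ ⊢⟨ SM ⟩ var k ∶ τ →
       ∃[ u ] ((Γ ! k) ≡ just u × u ≈U (τ ∷ [])))
    ×
    (∀ {Γ k τ} → Γ ⊢⟨ SMr ⟩ var k ∶ τ →
       ∃[ σs ] ∃[ a ] (τ ≈T (σs ⇛ tv a)))
    ×
    (∀ {M τ} → [] ⊢⟨ SM ⟩ ƛ M ∶ τ →
       (∃[ σ ] ((τ ≈T (ω ⇒ σ)) × ([] ⊢⟨ SM ⟩ M ∶ σ)))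
       ⊎ (∃[ σ ] ∃[ σ₁ ] ∃[ σs ]
            ((τ ≈T ((σ₁ ∷ σs) ⇒ σ)) × (((σ₁ ∷ σs) ∷ []) ⊢⟨ SM ⟩ M ∶ σ))))
    ×
    (∀ {Γ M τ} → Γ ⊢⟨ SM ⟩ ƛ M ∶ τ → 0 < length Γ →
       ∃[ u ] ∃[ σ ] ((τ ≈T (u ⇒ σ)) × ((u ∷ Γ) ⊢⟨ SM ⟩ M ∶ σ)))
    ×
    (∀ {Γ k τ} (Ms : List Term) → Γ ⊢⟨ SMr ⟩ apps (var k) Ms ∶ τ →
       ∃[ σ ] ∃[ ρs ] ∃[ a ] ∃[ Γs ]
         ((Γ ≈C (ωs k ((((tabulate {n = length Ms} σ) ⇛ τ) ∷ []) ∷ []) ∧C ⋀ (tabulate {n = length Ms} Γs)))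
          × (∀ (i : Fin (length Ms)) → Γs i ⊢⟨ SMr ⟩ lookup Ms i ∶ σ i)
          × (τ ≈T (ρs ⇛ tv a))))
lemma2p5 = var-lookup , varᵣ-type , closed-ƛ-inversion , open-ƛ-inversion , apps-inversion
  where
  varᵣ-type : ∀ {Γ k τ} → Γ ⊢⟨ SMr ⟩ var k ∶ τ → EndsInTyVar τ
  varᵣ-type d = let _ , _ , _ , _ , τ↓ = Spine-inversion head d in τ↓
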